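{- Let $G=(V,E)$ be a connected graph on $n$ vertices and let $i\in\{1,\ldots,n\}$. Then $z(G;i)=p(G;i)$ if and only if either $z(G;i)=p(G;i)=\binom{n}{i}$ or $z(G;i)=p(G;i)=0$.
   Context: Graphs are finite and simple. For $S\subseteq V$: $S$ is a power dominating set if, after coloring $S$, coloring every neighbor of a vertex of $S$ (domination step), and then repeatedly applying the forcing rule (a colored vertex with exactly one uncolored neighbor colors that neighbor) until no changes occur, all vertices are colored; $S$ is a zero forcing set if coloring $S$ and applying only the forcing rule repeatedly colors all vertices. $p(G;i)$ and $z(G;i)$ denote the numbers of power dominating sets and zero forcing sets of $G$ of size $i$. -}

module Defs where

open import Data.Nat using (ℕ; zero; suc; _+_)
open import Data.Bool using (Bool; true; false; _∧_; _∨_; not; if_then_else_)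
open import Data.Fin using (Fin)
open import Data.Fin.Subset using (Subset; ∣_∣; ⁅_⁆)
open import Data.Vec using (Vec; []; _∷_; tabulate; lookup)
open import Data.List using (List; []; _∷_; map; _++_; length; filter; allFin; foldr)
open import Data.Product using (Σ; ∃; _×_; _,_)
open import Relation.Binary.PropositionalEquality using (_≡_)
open import Relation.Nullary.Decidable using (Dec; yes; no)
open import Data.Nat using (_≟_)
open import Data.Bool using (T)

record Graph (n : ℕ) : Set where
  field
    adj   : Fin n → Fin n → Bool
    sym   : ∀ u v → adj u v ≡ adj v u
    irrefl : ∀ v → adj v v ≡ false
open Graph public

data Walk {n : ℕ} (G : Graph n) : Fin n → Fin n → Set where
  here : ∀ v → Walk G v v
  step : ∀ {u w v} → T (adj G u w) → Walk G w v → Walk G u v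

Connected : {n : ℕ} → Graph n → Set
Connected G = ∀ u v → Walk G u v

anyV : {n : ℕ} → (Fin n → Bool) → Bool
anyV f = foldr (λ x b → f x ∨ b) false (allFin _)

allV : {n : ℕ} → (Fin n → Bool) → Bool
allV f = foldr (λ x b → f x ∧ b) true (allFin _)

countV : {n : ℕ} → (Fin n → Bool) → ℕ
countV f = foldr (λ x k → if f x then suc k else k) 0 (allFin _)

uncoloredNbrs : {n : ℕ} → Graph n → Subset n → Fin n → ℕ
uncoloredNbrs G c u = countV (λ w → adj G u w ∧ not (lookup c w))

forceStep : {n : ℕ} → Graph n → Subset n → Subset n
forceStep G c = tabulate λ v →
  lookup c v ∨ anyV (λ u → lookup c u ∧ adj G u v ∧ isOne (uncoloredNbrs G c u))
  where
  isOne : ℕ → Bool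
  isOne 1 = true
  isOne _ = false

iterate : {A : Set} → ℕ → (A → A) → A → A
iterate zero f a = a
iterate (suc k) f a = iterate k f (f a)

-- Each round that changes anything colours at
-- least one new vertex, so after n rounds no further change is possible; the
-- final coloured set is independent of the order of forces.
forceClosure : {n : ℕ} → Graph n → Subset n → Subset n
forceClosure {n} G c = iterate n (forceStep G) c

closedNbhd : {n : ℕ} → Graph n → Subset n → Subset n
closedNbhd G S = tabulate λ v → lookup S v ∨ anyV (λ u → lookup S u ∧ adj G u v)

allColored : {n : ℕ} → Subset n → Bool
allColored c = allV (λ v → lookup c v)

isZeroForcing : {n : ℕ} → Graph n → Subset n → Bool
isZeroForcing G S = allColored (forceClosure G S)

isPowerDominating : {n : ℕ} → Graph n → Subset n → Bool
isPowerDominating G S = allColored (forceClosure G (closedNbhd G S))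

allSubsets : (n : ℕ) → List (Subset n)
allSubsets zero = [] ∷ []
allSubsets (suc n) = map (true ∷_) (allSubsets n) ++ map (false ∷_) (allSubsets n)

sizeIs : {n : ℕ} → ℕ → Subset n → Bool
sizeIs i S with ∣ S ∣ ≟ i
... | yes _ = true
... | no _ = false

countSubsets : {n : ℕ} → (Subset n → Bool) → ℕ
countSubsets {n} P = foldr (λ S k → if P S then suc k else k) 0 (allSubsets n)

z : {n : ℕ} → Graph n → ℕ → ℕ
z G i = countSubsets (λ S → sizeIs i S ∧ isZeroForcing G S)

p : {n : ℕ} → Graph n → ℕ → ℕ
p G i = countSubsets (λ S → sizeIs i S ∧ isPowerDominating G S)

-- Forcing is monotone in the initial colouring, so a set S' is power dominating as
-- soon as its closed neighbourhood N[S'] contains a zero forcing set; in particular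
-- every zero forcing set is power dominating.  Hence the zero forcing i-sets form a
-- sub-family of the power dominating i-sets, and z(G;i) = p(G;i) means that the two
-- families coincide.  In that case the zero forcing i-sets are closed under sliding
-- a token along an edge: if S is zero forcing, a ∈ S, b ∉ S and ab is an edge, then
-- S ⊆ N[S - a + b], so S - a + b is power dominating and therefore zero forcing.
-- In a connected graph token sliding links any two sets of equal size, so either no
-- i-set or every i-set is zero forcing, i.e. z = p = 0 or z = p = C(n,i).
module Submission where

open import Defs hiding (sym)
open import Data.Nat using (ℕ; zero; suc; _+_; _≤_; _<_; z≤n; s≤s; s≤s⁻¹; _≡ᵇ_)
import Data.Nat as ℕ
open import Data.Nat.Properties using (≤-antisym; ≤-refl; <-≤-trans; m≤n⇒m≤1+n; ≤-reflexive; <⇒≤; <-irrefl; <⇒≢; ≡ᵇ⇒≡)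
open import Data.Nat.Combinatorics using (_C_; nCk+nC[k+1]≡[n+1]C[k+1])
open import Data.Bool using (Bool; true; false; _∧_; _∨_; not; if_then_else_; T)
import Data.Bool as Bool
open import Data.List using (List; []; _∷_; map; _++_; foldr; allFin)
open import Data.List.Membership.Propositional using (_∈_)
open import Data.List.Membership.Propositional.Properties using (∈-allFin; ∈-map⁺; ∈-++⁺ˡ; ∈-++⁺ʳ)
open import Data.List.Relation.Unary.Any using (here; there)
open import Data.Product using (Σ; ∃; _×_; _,_; proj₁; proj₂)
open import Data.Sum using (_⊎_; inj₁; inj₂)
open import Data.Empty using (⊥-elim)
open import Data.Fin using (Fin; _≟_)
import Data.Fin as Fin
open import Data.Fin.Subset using (Subset; ∣_∣)
open import Data.Vec using ([]; _∷_; lookup; _[_]≔_)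
open import Data.Vec.Properties using (lookup∘tabulate; lookup∘update; lookup∘update′; []≔-idempotent; []≔-commutes; []≔-lookup; ≡-dec)
open import Function.Bundles using (_⇔_; mk⇔)
open import Relation.Binary.PropositionalEquality using (_≡_; _≢_; refl; sym; trans; cong; cong₂; subst; module ≡-Reasoning)
open import Relation.Nullary using (¬_; yes; no; does)

-- Counting with Boolean tests

module _ {A : Set} where

  -- The number of list elements passing a Boolean test; countV, countSubsets and
  -- uncoloredNbrs of Defs are instances of it.
  count : (A → Bool) → List A → ℕ
  count f = foldr (λ x k → if f x then suc k else k) 0

  anyᵇ : (A → Bool) → List A → Bool
  anyᵇ f = foldr (λ x b → f x ∨ b) false

  allᵇ : (A → Bool) → List A → Bool
  allᵇ f = foldr (λ x b → f x ∧ b) true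

  _⇒ᵇ_ : (A → Bool) → (A → Bool) → Set
  f ⇒ᵇ g = ∀ x → f x ≡ true → g x ≡ true

  count-mono : ∀ {f g} → f ⇒ᵇ g → ∀ xs → count f xs ≤ count g xs
  count-mono fg [] = z≤n
  count-mono {f} {g} fg (x ∷ xs) with f x in fx | g x in gx
  ... | true  | true  = s≤s (count-mono fg xs)
  ... | true  | false with () ← trans (sym (fg x fx)) gx
  ... | false | true  = m≤n⇒m≤1+n (count-mono fg xs)
  ... | false | false = count-mono fg xs

  count-pos : ∀ {f x xs} → x ∈ xs → f x ≡ true → 1 ≤ count f xs
  count-pos {f} {xs = y ∷ _} (here refl) fx rewrite fx = s≤s z≤n
  count-pos {f} {xs = y ∷ _} (there x∈) fx with f y
  ... | true  = s≤s z≤n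
  ... | false = count-pos x∈ fx

  count-strict : ∀ {f g x} → f ⇒ᵇ g → ∀ xs → x ∈ xs → f x ≡ false → g x ≡ true →
                 count f xs < count g xs
  count-strict fg (_ ∷ xs) (here refl) fx gx rewrite fx | gx = s≤s (count-mono fg xs)
  count-strict {f} {g} fg (y ∷ xs) (there x∈) fx gx with f y in fy | g y in gy
  ... | true  | true  = s≤s (count-strict fg xs x∈ fx gx)
  ... | true  | false with () ← trans (sym (fg y fy)) gy
  ... | false | true  = m≤n⇒m≤1+n (count-strict fg xs x∈ fx gx)
  ... | false | false = count-strict fg xs x∈ fx gx

  count-≡-reflect : ∀ {f g} → f ⇒ᵇ g → ∀ xs → count f xs ≡ count g xs →
                    ∀ {x} → x ∈ xs → g x ≡ true → f x ≡ true
  count-≡-reflect {f} fg xs same {x} x∈ gx with f x in fx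
  ... | true  = refl
  ... | false = ⊥-elim (<⇒≢ (count-strict fg xs x∈ fx gx) same)

  count-cong : ∀ {f g} → (∀ x → f x ≡ g x) → ∀ xs → count f xs ≡ count g xs
  count-cong f≗g [] = refl
  count-cong f≗g (x ∷ xs) rewrite f≗g x | count-cong f≗g xs = refl

  count-++ : ∀ f xs ys → count f (xs ++ ys) ≡ count f xs + count f ys
  count-++ f [] ys = refl
  count-++ f (x ∷ xs) ys with f x
  ... | true  = cong suc (count-++ f xs ys)
  ... | false = count-++ f xs ys

  count-false : ∀ xs → count (λ _ → false) xs ≡ 0
  count-false [] = refl
  count-false (_ ∷ xs) = count-false xs

  count-witness : ∀ f xs → ¬ count f xs ≡ 0 → ∃ λ x → f x ≡ true
  count-witness f [] nonzero = ⊥-elim (nonzero refl)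
  count-witness f (x ∷ xs) nonzero with f x in fx
  ... | true  = x , fx
  ... | false = count-witness f xs nonzero

  anyᵇ-intro : ∀ {f x xs} → x ∈ xs → f x ≡ true → anyᵇ f xs ≡ true
  anyᵇ-intro {f} {xs = y ∷ _} (here refl) fx rewrite fx = refl
  anyᵇ-intro {f} {xs = y ∷ _} (there x∈) fx with f y
  ... | true  = refl
  ... | false = anyᵇ-intro x∈ fx

  anyᵇ-elim : ∀ f xs → anyᵇ f xs ≡ true → ∃ λ x → f x ≡ true
  anyᵇ-elim f (x ∷ xs) any with f x in fx
  ... | true  = x , fx
  ... | false = anyᵇ-elim f xs any

  allᵇ-intro : ∀ {f} → (∀ x → f x ≡ true) → ∀ xs → allᵇ f xs ≡ true
  allᵇ-intro fx [] = refl
  allᵇ-intro fx (x ∷ xs) rewrite fx x = allᵇ-intro fx xs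

  allᵇ-elim : ∀ {f x xs} → allᵇ f xs ≡ true → x ∈ xs → f x ≡ true
  allᵇ-elim {f} {xs = y ∷ _} all x∈ with f y in fy
  allᵇ-elim all (here refl) | true = fy
  allᵇ-elim all (there x∈)  | true = allᵇ-elim all x∈

count-map : ∀ {A B : Set} (f : B → Bool) (g : A → B) xs →
            count f (map g xs) ≡ count (λ x → f (g x)) xs
count-map f g [] = refl
count-map f g (x ∷ xs) with f (g x)
... | true  = cong suc (count-map f g xs)
... | false = count-map f g xs

∨-elim : ∀ {a b} → a ∨ b ≡ true → a ≡ true ⊎ b ≡ true
∨-elim {true}  _ = inj₁ refl
∨-elim {false} b = inj₂ b

∨-introˡ : ∀ {a} b → a ≡ true → a ∨ b ≡ true
∨-introˡ b refl = refl

∨-introʳ : ∀ a {b} → b ≡ true → a ∨ b ≡ true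
∨-introʳ true  _ = refl
∨-introʳ false b = b

∧-elim : ∀ {a b} → a ∧ b ≡ true → a ≡ true × b ≡ true
∧-elim {true} b = refl , b

∧-intro : ∀ {a b} → a ≡ true → b ≡ true → a ∧ b ≡ true
∧-intro refl b = b

not-antitone : ∀ {a b} → (a ≡ true → b ≡ true) → not b ≡ true → not a ≡ true
not-antitone {false} _ _ = refl
not-antitone {true} {false} a⇒b _ with () ← a⇒b refl

T⇒≡true : ∀ {b} → T b → b ≡ true
T⇒≡true {true} _ = refl

-- Monotonicity of forcing

record _⊆_ {n} (c d : Subset n) : Set where
  constructor mk⊆
  field ⊆-app : ∀ v → lookup c v ≡ true → lookup d v ≡ true
open _⊆_

module _ {n} (G : Graph n) where

  -- forceStep tests "u has exactly one uncoloured neighbour" with a function local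
  -- to Defs; unification recovers that test as forceRule.
  forceStep-shape : Σ (Subset n → Fin n → Bool) λ R → ∀ c v →
    lookup (forceStep G c) v ≡ lookup c v ∨ anyV (λ u → lookup c u ∧ adj G u v ∧ R c u)
  forceStep-shape = _ , λ c v → lookup∘tabulate _ v

  forceRule : Subset n → Fin n → Bool
  forceRule = proj₁ forceStep-shape

  forceStep-lookup : ∀ c v →
    lookup (forceStep G c) v ≡ lookup c v ∨ anyV (λ u → lookup c u ∧ adj G u v ∧ forceRule c u)
  forceStep-lookup = proj₂ forceStep-shape

  forceRule-sound : ∀ c u → forceRule c u ≡ true → uncoloredNbrs G c u ≡ 1
  forceRule-sound c u fires with uncoloredNbrs G c u | fires
  ... | suc zero | _ = refl

  forceRule-complete : ∀ c u → uncoloredNbrs G c u ≡ 1 → forceRule c u ≡ true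
  forceRule-complete c u one rewrite one = refl

  sole-uncolored-persists : ∀ {c d} → c ⊆ d → ∀ u v → uncoloredNbrs G c u ≡ 1 →
    adj G u v ≡ true → lookup d v ≡ false → uncoloredNbrs G d u ≡ 1
  sole-uncolored-persists {c} {d} c⊆d u v one uv dv =
    ≤-antisym (subst (_ ≤_) one (count-mono fewer (allFin _)))
              (count-pos (∈-allFin v) (∧-intro uv (cong not dv)))
    where
    fewer : (λ w → adj G u w ∧ not (lookup d w)) ⇒ᵇ (λ w → adj G u w ∧ not (lookup c w))
    fewer w h with ∧-elim h
    ... | uw , dw = ∧-intro uw (not-antitone (⊆-app c⊆d w) dw)

  -- One round of forcing preserves inclusion of colourings: a force u → v under c
  -- is still available under d unless v is already coloured there.
  forceStep-mono : ∀ {c d} → c ⊆ d → forceStep G c ⊆ forceStep G d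
  forceStep-mono {c} {d} c⊆d = mk⊆ λ v h → forced v (subst (_≡ true) (forceStep-lookup c v) h)
    where
    colored : ∀ v → lookup d v ∨ anyV (λ u → lookup d u ∧ adj G u v ∧ forceRule d u) ≡ true →
              lookup (forceStep G d) v ≡ true
    colored v any = trans (forceStep-lookup d v) any
    forced : ∀ v → lookup c v ∨ anyV (λ u → lookup c u ∧ adj G u v ∧ forceRule c u) ≡ true →
             lookup (forceStep G d) v ≡ true
    forced v h with ∨-elim h
    ... | inj₁ cv = colored v (∨-introˡ _ (⊆-app c⊆d v cv))
    ... | inj₂ any with anyᵇ-elim _ (allFin _) any
    ... | u , fires with ∧-elim fires
    ... | cu , rest with ∧-elim rest
    ... | uv , rule with lookup d v in dv
    ... | true  = colored v (∨-introˡ _ dv)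
    ... | false = colored v (∨-introʳ _ (anyᵇ-intro (∈-allFin u) (∧-intro (⊆-app c⊆d u cu)
                    (∧-intro uv (forceRule-complete d u
                      (sole-uncolored-persists c⊆d u v (forceRule-sound c u rule) uv dv))))))

iterate-mono : ∀ {n} {f : Subset n → Subset n} → (∀ {c d} → c ⊆ d → f c ⊆ f d) →
               ∀ k {c d} → c ⊆ d → iterate k f c ⊆ iterate k f d
iterate-mono f-mono zero    c⊆d = c⊆d
iterate-mono f-mono (suc k) c⊆d = iterate-mono f-mono k (f-mono c⊆d)

allColored-mono : ∀ {n} {c d : Subset n} → c ⊆ d → allColored c ≡ true → allColored d ≡ true
allColored-mono c⊆d all = allᵇ-intro (λ v → ⊆-app c⊆d v (allᵇ-elim all (∈-allFin v))) (allFin _)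

module _ {n} (G : Graph n) where

  ⊆-closedNbhd : ∀ S → S ⊆ closedNbhd G S
  ⊆-closedNbhd S = mk⊆ λ v Sv → trans (lookup∘tabulate _ v) (∨-introˡ _ Sv)

  closedNbhd-adj : ∀ S u v → lookup S u ≡ true → adj G u v ≡ true → lookup (closedNbhd G S) v ≡ true
  closedNbhd-adj S u v Su uv =
    trans (lookup∘tabulate _ v) (∨-introʳ _ (anyᵇ-intro (∈-allFin u) (∧-intro Su uv)))

  power-dominating-if-covers : ∀ S S' → S ⊆ closedNbhd G S' →
    isZeroForcing G S ≡ true → isPowerDominating G S' ≡ true
  power-dominating-if-covers S S' S⊆N =
    allColored-mono (iterate-mono (forceStep-mono G) n S⊆N)

move : ∀ {n} → Subset n → Fin n → Fin n → Subset n
move S a b = (S [ a ]≔ false) [ b ]≔ true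

module _ {n} (S : Subset n) where

  occupied≢free : ∀ {a b} → lookup S a ≡ true → lookup S b ≡ false → a ≢ b
  occupied≢free Sa Sb refl with () ← trans (sym Sa) Sb

  move-target : ∀ a b → lookup (move S a b) b ≡ true
  move-target a b = lookup∘update b (S [ a ]≔ false) true

  move-source : ∀ a b → a ≢ b → lookup (move S a b) a ≡ false
  move-source a b a≢b = trans (lookup∘update′ a≢b (S [ a ]≔ false) true) (lookup∘update a S false)

  move-other : ∀ a b j → j ≢ a → j ≢ b → lookup (move S a b) j ≡ lookup S j
  move-other a b j j≢a j≢b = trans (lookup∘update′ j≢b (S [ a ]≔ false) true) (lookup∘update′ j≢a S false)

  move-via-free : ∀ {a x} y → lookup S a ≡ true → lookup S x ≡ false →
                  move (move S a x) x y ≡ move S a y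
  move-via-free {a} {x} y Sa Sx = cong (_[ y ]≔ true) (begin
      ((S′ [ x ]≔ true) [ x ]≔ false)  ≡⟨ []≔-idempotent S′ x ⟩
      S′ [ x ]≔ false                  ≡⟨ cong (S′ [ x ]≔_) (sym S′x) ⟩
      S′ [ x ]≔ lookup S′ x            ≡⟨ []≔-lookup S′ x ⟩
      S′                               ∎)
    where
    open ≡-Reasoning
    S′ : Subset n
    S′ = S [ a ]≔ false
    S′x : lookup S′ x ≡ false
    S′x = trans (lookup∘update′ (λ x≡a → occupied≢free Sa Sx (sym x≡a)) S false) Sx

  move-via-occupied : ∀ {a x y} → a ≢ x → lookup S a ≡ true → lookup S x ≡ true →
                      lookup S y ≡ false → move (move S x y) a x ≡ move S a y
  move-via-occupied {a} {x} {y} a≢x Sa Sx Sy = begin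
    (((S₀ [ y ]≔ true) [ a ]≔ false) [ x ]≔ true)  ≡⟨ cong (_[ x ]≔ true) ([]≔-commutes S₀ y a (λ y≡a → a≢y (sym y≡a))) ⟩
    (((S₀ [ a ]≔ false) [ y ]≔ true) [ x ]≔ true)  ≡⟨ []≔-commutes (S₀ [ a ]≔ false) y x (λ y≡x → x≢y (sym y≡x)) ⟩
    (((S₀ [ a ]≔ false) [ x ]≔ true) [ y ]≔ true)  ≡⟨ cong (λ V → (V [ x ]≔ true) [ y ]≔ true) ([]≔-commutes S x a (λ x≡a → a≢x (sym x≡a))) ⟩
    ((((S′ [ x ]≔ false) [ x ]≔ true) [ y ]≔ true)) ≡⟨ cong (_[ y ]≔ true) ([]≔-idempotent S′ x) ⟩
    ((S′ [ x ]≔ true) [ y ]≔ true)                  ≡⟨ cong (λ b → (S′ [ x ]≔ b) [ y ]≔ true) (sym S′x) ⟩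
    ((S′ [ x ]≔ lookup S′ x) [ y ]≔ true)           ≡⟨ cong (_[ y ]≔ true) ([]≔-lookup S′ x) ⟩
    move S a y                                      ∎
    where
    open ≡-Reasoning
    S₀ S′ : Subset n
    S₀ = S [ x ]≔ false
    S′ = S [ a ]≔ false
    a≢y : a ≢ y
    a≢y = occupied≢free Sa Sy
    x≢y : x ≢ y
    x≢y = occupied≢free Sx Sy
    S′x : lookup S′ x ≡ true
    S′x = trans (lookup∘update′ (λ x≡a → a≢x (sym x≡a)) S false) Sx

∣remove∣ : ∀ {n} (S : Subset n) a → lookup S a ≡ true → suc ∣ S [ a ]≔ false ∣ ≡ ∣ S ∣
∣remove∣ (true  ∷ S) Fin.zero    refl = refl
∣remove∣ (true  ∷ S) (Fin.suc a) Sa   = cong suc (∣remove∣ S a Sa)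
∣remove∣ (false ∷ S) (Fin.suc a) Sa   = ∣remove∣ S a Sa

∣insert∣ : ∀ {n} (S : Subset n) b → lookup S b ≡ false → ∣ S [ b ]≔ true ∣ ≡ suc ∣ S ∣
∣insert∣ (false ∷ S) Fin.zero    refl = refl
∣insert∣ (true  ∷ S) (Fin.suc b) Sb   = cong suc (∣insert∣ S b Sb)
∣insert∣ (false ∷ S) (Fin.suc b) Sb   = ∣insert∣ S b Sb

move-size : ∀ {n} (S : Subset n) {a b} → lookup S a ≡ true → lookup S b ≡ false → ∣ move S a b ∣ ≡ ∣ S ∣
move-size S {a} {b} Sa Sb =
  trans (∣insert∣ (S [ a ]≔ false) b (trans (lookup∘update′ b≢a S false) Sb)) (∣remove∣ S a Sa)
  where
  b≢a : b ≢ a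
  b≢a b≡a = occupied≢free S Sa Sb (sym b≡a)

difference-witness : ∀ {n} (S T : Subset n) → ∣ T ∣ ≤ ∣ S ∣ → S ≢ T →
                     ∃ λ a → lookup S a ≡ true × lookup T a ≡ false
difference-witness [] [] _ S≢T = ⊥-elim (S≢T refl)
difference-witness (true ∷ S) (false ∷ T) _ _ = Fin.zero , refl , refl
difference-witness (true ∷ S) (true ∷ T) T≤S S≢T
  with a , Sa , Ta ← difference-witness S T (s≤s⁻¹ T≤S) (λ S≡T → S≢T (cong (true ∷_) S≡T)) = Fin.suc a , Sa , Ta
difference-witness (false ∷ S) (false ∷ T) T≤S S≢T
  with a , Sa , Ta ← difference-witness S T T≤S (λ S≡T → S≢T (cong (false ∷_) S≡T)) = Fin.suc a , Sa , Ta
difference-witness (false ∷ S) (true ∷ T) T<S _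
  with a , Sa , Ta ← difference-witness S T (<⇒≤ T<S) (λ { refl → <-irrefl refl T<S }) = Fin.suc a , Sa , Ta

mismatch : ∀ {n} → Subset n → Subset n → ℕ
mismatch S T = count (λ j → lookup S j ∧ not (lookup T j)) (allFin _)

mismatch-decreases : ∀ {n} (S T : Subset n) {a b} → lookup S a ≡ true → lookup T a ≡ false →
  lookup S b ≡ false → lookup T b ≡ true → mismatch (move S a b) T < mismatch S T
mismatch-decreases S T {a} {b} Sa Ta Sb Tb =
  count-strict fewer (allFin _) (∈-allFin a) (cong (_∧ not (lookup T a)) (move-source S a b a≢b))
               (∧-intro Sa (cong not Ta))
  where
  a≢b : a ≢ b
  a≢b = occupied≢free S Sa Sb
  fewer : (λ j → lookup (move S a b) j ∧ not (lookup T j)) ⇒ᵇ (λ j → lookup S j ∧ not (lookup T j))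
  fewer j h with ∧-elim h | j ≟ b | j ≟ a
  ... | _ , notTj | yes refl | _ with () ← trans (sym notTj) (cong not Tb)
  ... | Mj , _    | no _     | yes refl with () ← trans (sym Mj) (move-source S a b a≢b)
  ... | Mj , notTj | no j≢b  | no j≢a = ∧-intro (trans (sym (move-other S a b j j≢a j≢b)) Mj) notTj

-- Token sliding in a connected graph

adjacent-distinct : ∀ {n} (G : Graph n) {a b} → T (adj G a b) → a ≢ b
adjacent-distinct G {a} ab refl with () ← trans (sym (T⇒≡true ab)) (irrefl G a)

module TokenSliding {n} (G : Graph n) (P : Subset n → Set)
  (slide : ∀ {S a b} → P S → lookup S a ≡ true → lookup S b ≡ false → T (adj G a b) → P (move S a b))
  where

  -- A token can be moved along any walk to a vacant end vertex: tokens met on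
  -- the way are pushed forward first, vacant vertices are stepped through.
  slide-along : ∀ {a y} → Walk G a y → ∀ {S} → P S → lookup S a ≡ true → lookup S y ≡ false →
                P (move S a y)
  slide-along (here a) {S} _ Sa Sy = ⊥-elim (occupied≢free S Sa Sy refl)
  slide-along (step {a} {x} {y} ax walk) {S} PS Sa Sy with lookup S x in Sx | x ≟ y
  ... | false | yes refl = slide PS Sa Sx ax
  ... | false | no x≢y   =
    subst P (move-via-free S y Sa Sx)
      (slide-along walk (slide PS Sa Sx ax) (move-target S a x)
        (trans (move-other S a x y (λ y≡a → occupied≢free S Sa Sy (sym y≡a)) (λ y≡x → x≢y (sym y≡x))) Sy))
  ... | true  | _ =
    subst P (move-via-occupied S a≢x Sa Sx Sy)
      (slide (slide-along walk PS Sx Sy)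
        (trans (move-other S x y a a≢x (occupied≢free S Sa Sy)) Sa)
        (move-source S x y (occupied≢free S Sx Sy)) ax)
    where
    a≢x : a ≢ x
    a≢x = adjacent-distinct G ax

  spread : Connected G → ∀ S T → P S → ∣ S ∣ ≡ ∣ T ∣ → P T
  spread conn S T PS same = go (suc (mismatch S T)) S T ≤-refl PS same
    where
    go : ∀ fuel S T → mismatch S T < fuel → P S → ∣ S ∣ ≡ ∣ T ∣ → P T
    go (suc fuel) S T bound PS same with ≡-dec Bool._≟_ S T
    ... | yes refl = PS
    ... | no S≢T
      with a , Sa , Ta ← difference-witness S T (≤-reflexive (sym same)) S≢T
         | b , Tb , Sb ← difference-witness T S (≤-reflexive same) (λ T≡S → S≢T (sym T≡S))
      = go fuel (move S a b) T (<-≤-trans (mismatch-decreases S T Sa Ta Sb Tb) (s≤s⁻¹ bound))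
           (slide-along (conn a b) PS Sa Sb) (trans (move-size S Sa Sb) same)

allSubsets-complete : ∀ n (S : Subset n) → S ∈ allSubsets n
allSubsets-complete zero [] = here refl
allSubsets-complete (suc n) (true ∷ S) = ∈-++⁺ˡ (∈-map⁺ (true ∷_) (allSubsets-complete n S))
allSubsets-complete (suc n) (false ∷ S) =
  ∈-++⁺ʳ (map (true ∷_) (allSubsets n)) (∈-map⁺ (false ∷_) (allSubsets-complete n S))

-- sizeIs is the Boolean size test ∣ S ∣ ≡ᵇ i, which computes on the first entry.
sizeIs-≡ᵇ : ∀ {n} i (S : Subset n) → sizeIs i S ≡ (∣ S ∣ ≡ᵇ i)
sizeIs-≡ᵇ i S with ∣ S ∣ ℕ.≟ i in eq
... | yes _ = sym (cong does eq)
... | no _  = sym (cong does eq)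

sizeIs-resize : ∀ {n} i {S S′ : Subset n} → ∣ S ∣ ≡ ∣ S′ ∣ → sizeIs i S ≡ sizeIs i S′
sizeIs-resize i {S} {S′} same =
  trans (sizeIs-≡ᵇ i S) (trans (cong (_≡ᵇ i) same) (sym (sizeIs-≡ᵇ i S′)))

sizeIs-sound : ∀ {n} i (S : Subset n) → sizeIs i S ≡ true → ∣ S ∣ ≡ i
sizeIs-sound i S h = ≡ᵇ⇒≡ ∣ S ∣ i (subst T (trans (sym h) (sizeIs-≡ᵇ i S)) _)

-- There are C(n,i) subsets of size i (Pascal's rule on the first entry).
count-size : ∀ n i → count (sizeIs i) (allSubsets n) ≡ n C i
count-size n i = trans (count-cong (sizeIs-≡ᵇ i) (allSubsets n)) (count-size-≡ᵇ n i)
  where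
  count-size-≡ᵇ : ∀ n i → count (λ S → ∣ S ∣ ≡ᵇ i) (allSubsets n) ≡ n C i
  count-size-≡ᵇ zero zero = refl
  count-size-≡ᵇ zero (suc i) = refl
  count-size-≡ᵇ (suc n) i = begin
    count has-size (map (true ∷_) Ss ++ map (false ∷_) Ss)
      ≡⟨ count-++ has-size (map (true ∷_) Ss) (map (false ∷_) Ss) ⟩
    count has-size (map (true ∷_) Ss) + count has-size (map (false ∷_) Ss)
      ≡⟨ cong₂ _+_ (count-map has-size (true ∷_) Ss) (count-map has-size (false ∷_) Ss) ⟩
    count (λ S → suc ∣ S ∣ ≡ᵇ i) Ss + count (λ S → ∣ S ∣ ≡ᵇ i) Ss
      ≡⟨ pascal i ⟩
    suc n C i ∎
    where
    open ≡-Reasoning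
    Ss : List (Subset n)
    Ss = allSubsets n
    has-size : Subset (suc n) → Bool
    has-size S = ∣ S ∣ ≡ᵇ i
    pascal : ∀ i → count (λ S → suc ∣ S ∣ ≡ᵇ i) Ss + count (λ S → ∣ S ∣ ≡ᵇ i) Ss ≡ suc n C i
    pascal zero    = cong₂ _+_ (count-false Ss) (count-size-≡ᵇ n zero)
    pascal (suc j) = trans (cong₂ _+_ (count-size-≡ᵇ n j) (count-size-≡ᵇ n (suc j)))
                           (nCk+nC[k+1]≡[n+1]C[k+1] n j)

slide-closed-dichotomy : ∀ {n} (G : Graph n) → Connected G → ∀ i (Q : Subset n → Bool) →
  (∀ S → Q S ≡ true → sizeIs i S ≡ true) →
  (∀ {S a b} → Q S ≡ true → lookup S a ≡ true → lookup S b ≡ false → T (adj G a b) → Q (move S a b) ≡ true) →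
  count Q (allSubsets n) ≡ 0 ⊎ count Q (allSubsets n) ≡ n C i
slide-closed-dichotomy {n} G conn i Q sized slide with count Q (allSubsets n) ℕ.≟ 0
... | yes none = inj₁ none
... | no some with S₀ , QS₀ ← count-witness Q (allSubsets n) some =
  inj₂ (trans (count-cong every-i-set (allSubsets n)) (count-size n i))
  where
  open TokenSliding G (λ S → Q S ≡ true) slide
  every-i-set : ∀ S → Q S ≡ sizeIs i S
  every-i-set S with sizeIs i S in sizeS | Q S in QS
  ... | true  | true  = refl
  ... | false | false = refl
  ... | false | true  = trans (sym (sized S QS)) sizeS
  ... | true  | false = trans (sym QS)
    (spread conn S₀ S QS₀ (trans (sizeIs-sound i S₀ (sized S₀ QS₀)) (sym (sizeIs-sound i S sizeS))))

-- Zero forcing and power dominating i-sets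

module _ {n} (G : Graph n) (i : ℕ) where

  zfSet pdSet : Subset n → Bool
  zfSet S = sizeIs i S ∧ isZeroForcing G S
  pdSet S = sizeIs i S ∧ isPowerDominating G S

  zfSet⇒pdSet : zfSet ⇒ᵇ pdSet
  zfSet⇒pdSet S h with sizeS , zf ← ∧-elim h =
    ∧-intro sizeS (power-dominating-if-covers G S S (⊆-closedNbhd G S) zf)

  -- After sliding the token on a to a neighbour b, the vertex a is dominated by b.
  covered-after-move : ∀ S {a b} → lookup S a ≡ true → lookup S b ≡ false → T (adj G a b) →
                       S ⊆ closedNbhd G (move S a b)
  covered-after-move S {a} {b} Sa Sb ab = mk⊆ covered
    where
    covered : ∀ v → lookup S v ≡ true → lookup (closedNbhd G (move S a b)) v ≡ true
    covered v Sv with v ≟ a | v ≟ b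
    ... | yes refl | _ = closedNbhd-adj G (move S a b) b v (move-target S a b)
                           (trans (Graph.sym G b v) (T⇒≡true ab))
    ... | no _ | yes refl = ⊆-app (⊆-closedNbhd G (move S a b)) v (move-target S a v)
    ... | no v≢a | no v≢b = ⊆-app (⊆-closedNbhd G (move S a b)) v (trans (move-other S a b v v≢a v≢b) Sv)

  zfSet-slide : z G i ≡ p G i → ∀ {S a b} → zfSet S ≡ true → lookup S a ≡ true →
                lookup S b ≡ false → T (adj G a b) → zfSet (move S a b) ≡ true
  zfSet-slide z≡p {S} {a} {b} h Sa Sb ab with sizeS , zf ← ∧-elim h =
    count-≡-reflect zfSet⇒pdSet (allSubsets n) z≡p (allSubsets-complete n (move S a b))
      (∧-intro (trans (sizeIs-resize i (move-size S Sa Sb)) sizeS)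
               (power-dominating-if-covers G S (move S a b) (covered-after-move S Sa Sb ab) zf))

theorem14 : (n : ℕ) (G : Graph n) → Connected G → (i : ℕ) → 1 ≤ i → i ≤ n →
    (z G i ≡ p G i) ⇔ ((z G i ≡ n C i × p G i ≡ n C i) ⊎ (z G i ≡ 0 × p G i ≡ 0))
theorem14 n G conn i _ _ = mk⇔ forward backward
  where
  forward : z G i ≡ p G i → (z G i ≡ n C i × p G i ≡ n C i) ⊎ (z G i ≡ 0 × p G i ≡ 0)
  forward z≡p with slide-closed-dichotomy G conn i (zfSet G i)
                     (λ S h → proj₁ (∧-elim h)) (zfSet-slide G i z≡p)
  ... | inj₁ z≡0 = inj₂ (z≡0 , trans (sym z≡p) z≡0)
  ... | inj₂ z≡C = inj₁ (z≡C , trans (sym z≡p) z≡C)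

  backward : (z G i ≡ n C i × p G i ≡ n C i) ⊎ (z G i ≡ 0 × p G i ≡ 0) → z G i ≡ p G i
  backward (inj₁ (z≡C , p≡C)) = trans z≡C (sym p≡C)
  backward (inj₂ (z≡0 , p≡0)) = trans z≡0 (sym p≡0)
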